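{- Assume the multicolor Erdős–Hajnal conjecture: for all integers $k,m\ge 2$ and every coloring $\chi$ of $E(K_k)$ with $m$ colors, there exists $\varepsilon>0$ such that every coloring of the edges of $K_n$ with these $m$ colors contains either $k$ vertices whose edges are colored according to $\chi$ (a copy of $\chi$) or a set of $n^\varepsilon$ vertices whose edges use at most $m-1$ colors. Let $c,r$ be fixed positive integers and let $H$ be a fixed grid subgraph on $c$ columns and $r$ rows all of whose edges are horizontal, such that no two edges of $H$ join the same two columns. Then there exists $M$ such that for all $k$ and all $N>k^M$, every spanning grid subgraph $G$ of $G_{N\times r}$ (with $N$ columns and $r$ rows) contains either a horizontal coclique of size $k$ or a copy of $H$.
   Context: A grid subgraph on $c$ columns and $r$ rows is a graph whose vertex set is a subset of $[c]\times[r]$ (vertex $(x,y)$ in column $x$, row $y$) and whose edges each join two vertices in the same row (horizontal edge) or the same column (vertical edge). $G_{N\times r}=K_N\square K_r$ is the complete grid graph on $N$ columns and $r$ rows. A copy (embedding) of $H$ in $G$ is a pair of injections $\varphi_c:[c]\to[N]$, $\varphi_r:[r]\to[r]$ sending each edge $\{(x,y),(x',y')\}$ of $H$ to an edge $\{(\varphi_c(x),\varphi_r(y)),(\varphi_c(x'),\varphi_r(y'))\}$ of $G$. A horizontal coclique of size $k$ is a set of $k$ vertices in a single row, no two adjacent in $G$. -}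

module Defs where

open import Data.Nat using (ℕ; _≤_; _^_; _<_; _≥_)
open import Data.Fin using (Fin)
open import Data.Bool using (Bool; true; false)
open import Data.Product using (Σ; ∃; _×_; _,_)
open import Data.Sum using (_⊎_)
open import Relation.Binary.PropositionalEquality using (_≡_; _≢_)
open import Function.Definitions using (Injective)

-- An m-coloring of E(K_n): a symmetric function on pairs of vertices
-- (the value on the diagonal is irrelevant and never used).
record EdgeColoring (n m : ℕ) : Set where
  field
    col : Fin n → Fin n → Fin m
    sym : ∀ u v → col u v ≡ col v u
open EdgeColoring public

ContainsCopy : ∀ {k n m} → EdgeColoring k m → EdgeColoring n m → Set
ContainsCopy {k} {n} χ c =
  Σ (Fin k → Fin n) λ f → Injective _≡_ _≡_ f ×
    (∀ i j → i ≢ j → col c (f i) (f j) ≡ col χ i j)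

FewColorSet : ∀ {n m} → EdgeColoring n m → (s : ℕ) → Set
FewColorSet {n} {m} c s =
  Σ (Fin s → Fin n) λ g → Injective _≡_ _≡_ g ×
    Σ (Fin m) λ a → ∀ i j → i ≢ j → col c (g i) (g j) ≢ a

-- Multicolor Erdős–Hajnal conjecture.  "There is ε>0 ... a set of n^ε
-- vertices" is expressed with ε = 1/d (d ≥ 1): a set of s vertices
-- with n ≤ s^d, i.e. s ≥ n^(1/d).  (Equivalent, since the property is
-- monotone in ε.)
MulticolorEH : Set
MulticolorEH =
  ∀ (k m : ℕ) → 2 ≤ k → 2 ≤ m → (χ : EdgeColoring k m) →
    Σ ℕ λ d → 1 ≤ d ×
      (∀ (n : ℕ) (c : EdgeColoring n m) →
         ContainsCopy χ c ⊎ Σ ℕ (λ s → n ≤ s ^ d × FewColorSet c s))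

T : Bool → Set
T b = b ≡ true

record GridSubgraph (c r : ℕ) : Set where
  field
    V : Fin c → Fin r → Bool
    E : Fin c → Fin r → Fin c → Fin r → Bool
    E-sym : ∀ x y x' y' → T (E x y x' y') → T (E x' y' x y)
    E-V : ∀ x y x' y' → T (E x y x' y') → T (V x y) × T (V x' y')
    E-irrefl : ∀ x y → E x y x y ≡ false
    E-grid : ∀ x y x' y' → T (E x y x' y') → x ≡ x' ⊎ y ≡ y'
open GridSubgraph public

AllHorizontal : ∀ {c r} → GridSubgraph c r → Set
AllHorizontal H = ∀ x y x' y' → T (E H x y x' y') → y ≡ y'

DistinctColumnPairs : ∀ {c r} → GridSubgraph c r → Set
DistinctColumnPairs H =
  ∀ x x' y y' z z' → T (E H x y x' y') → T (E H x z x' z') → y ≡ z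

Spanning : ∀ {N r} → GridSubgraph N r → Set
Spanning G = ∀ x y → T (V G x y)

HorizontalCoclique : ∀ {N r} → GridSubgraph N r → ℕ → Set
HorizontalCoclique {N} {r} G k =
  Σ (Fin r) λ y → Σ (Fin k → Fin N) λ g → Injective _≡_ _≡_ g ×
    (∀ i → T (V G (g i) y)) ×
    (∀ i j → E G (g i) y (g j) y ≡ false)

CopyOf : ∀ {c r N} → GridSubgraph c r → GridSubgraph N r → Set
CopyOf {c} {r} {N} H G =
  Σ (Fin c → Fin N) λ φc → Σ (Fin r → Fin r) λ φr →
    Injective _≡_ _≡_ φc × Injective _≡_ _≡_ φr ×
    (∀ x y x' y' → T (E H x y x' y') →
       T (E G (φc x) (φr y) (φc x') (φr y')))

{-# OPTIONS --safe #-}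
module Submission where

-- Read a spanning G as an edge coloring of K_N whose color on {u, v} is the set of rows in
-- which the columns u and v are adjacent; then H is a pattern of such colors on K_c, and the
-- theorem follows from a statement about colorings by m colors, each read as a set of rows,
-- proved by induction on m. If some row lies in no color, all n vertices form a coclique in
-- that row. Otherwise pick a color a(y) containing each row y and color K_c by giving the
-- pair of columns joined in row y the color a(y) (well defined as no two edges of H join the
-- same columns). By the multicolor Erdős–Hajnal property either this pattern occurs, which
-- is a copy of H, or some n^(1/d) vertices miss a color; on them only m − 1 colors remain,
-- and the induction hypothesis applies there, the exponents multiplying.

open import Defs hiding (sym)
open import Data.Nat using (ℕ; zero; suc; s≤s⁻¹; _≤_; _<_; _^_; _*_; z≤n; s≤s; _≤?_; _<?_)
open import Data.Nat.Properties
  using ( ≤-trans; <-≤-trans; m≤n⇒m≤n+o; n≤1+n; m^n>0; +-mono-≤; ^-identityʳ; ^-monoˡ-≤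
        ; ^-monoʳ-≤; ^-*-assoc; ≰⇒>; ≮⇒≥; <⇒≤; <⇒≱; module ≤-Reasoning)
open import Data.Fin using (Fin; zero; suc; punchIn; punchOut; inject≤; combine; funToFin; finToFun)
open import Data.Fin.Properties
  using ( _≟_; any?; all?; ¬∀⟶∃¬; ¬Fin0; punchIn-punchOut; inject≤-injective
        ; finToFun-funToFin; 2↔Bool)
open import Data.Bool using (Bool; true; false)
open import Data.Bool.Properties using (⇔→≡; ¬-not) renaming (_≟_ to _≟ᵇ_)
open import Data.List using (tabulate)
open import Data.List.Extrema.Nat using (max; xs≤max)
open import Data.List.Relation.Unary.All.Properties using (tabulate⁻)
open import Data.Product using (Σ; ∃; _×_; _,_; proj₁; proj₂)
open import Data.Sum using (_⊎_; inj₁; inj₂; [_,_]′)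
import Data.Sum as Sum
open import Function using (_∘_; id; Inverse; mk⇔)
open import Function.Definitions using (Injective)
open import Relation.Nullary using (Dec; yes; no; contradiction)
open import Relation.Binary.PropositionalEquality
  using (_≡_; _≢_; _≗_; refl; sym; trans; cong; cong₂; subst; ≢-sym)

n<2^n : ∀ n → n < 2 ^ n
n<2^n zero    = s≤s z≤n
n<2^n (suc n) = +-mono-≤ (m^n>0 2 n) (m≤n⇒m≤n+o 0 (n<2^n n))

^-cancelʳ-< : ∀ e {k l} → k ^ e < l ^ e → k < l
^-cancelʳ-< e {k} {l} kᵉ<lᵉ with k <? l
... | yes k<l = k<l
... | no  k≮l = contradiction (^-monoˡ-≤ e (≮⇒≥ k≮l)) (<⇒≱ kᵉ<lᵉ)

nested-power-bound : ∀ {n s t d D e} → n ≤ s ^ e → s ≤ suc t ^ d → d ≤ D → n ≤ suc t ^ (D * e)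
nested-power-bound {n} {s} {t} {d} {D} {e} n≤sᵉ s≤tᵈ d≤D = begin
  n                 ≤⟨ n≤sᵉ ⟩
  s ^ e             ≤⟨ ^-monoˡ-≤ e (≤-trans s≤tᵈ (^-monoʳ-≤ (suc t) d≤D)) ⟩
  (suc t ^ D) ^ e   ≡⟨ ^-*-assoc (suc t) D e ⟩
  suc t ^ (D * e)   ∎
  where open ≤-Reasoning

E-sym-≡ : ∀ {c r} (G : GridSubgraph c r) x y x' y' → E G x y x' y' ≡ E G x' y' x y
E-sym-≡ G x y x' y' = ⇔→≡ (mk⇔ (E-sym G x y x' y') (E-sym G x' y' x y))

sameRowEdge⇒≢ : ∀ {c r} (G : GridSubgraph c r) {x x' y} → T (E G x y x' y) → x ≢ x'
sameRowEdge⇒≢ G {x} {y = y} e refl with () ← trans (sym e) (E-irrefl G x y)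

-- Throughout, rows a y says that the color a, read as a set of rows, contains the row y.
module _ {r n m : ℕ} (rows : Fin m → Fin r → Bool) (κ : EdgeColoring n m) where

  ColoredCoclique : ℕ → Set
  ColoredCoclique s = Σ (Fin r) λ y → Σ (Fin s → Fin n) λ g → Injective _≡_ _≡_ g ×
    (∀ i j → i ≢ j → rows (col κ (g i) (g j)) y ≡ false)

module _ {c r : ℕ} (H : GridSubgraph c r) where

  ColoredCopy : ∀ {n m} → (Fin m → Fin r → Bool) → EdgeColoring n m → Set
  ColoredCopy {n} rows κ = Σ (Fin c → Fin n) λ f → Injective _≡_ _≡_ f ×
    (∀ x y x' → T (E H x y x' y) → T (rows (col κ (f x) (f x')) y))

  -- A coclique of s vertices is weighed as s + 1: under a single color containing every row,
  -- cocliques have at most one vertex, yet n ≤ (s + 1) ^ d must hold for every n < c.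
  CopyOrLargeCoclique : ∀ {m} → (Fin m → Fin r → Bool) → ℕ → Set
  CopyOrLargeCoclique {m} rows d = ∀ n (κ : EdgeColoring n m) →
    ColoredCopy rows κ ⊎ Σ ℕ λ s → n ≤ suc s ^ d × ColoredCoclique rows κ s

squeeze : ∀ {m} → Fin (suc (suc m)) → Fin (suc (suc m)) → Fin (suc m)
squeeze b x with b ≟ x
... | yes _   = zero
... | no  b≢x = punchOut b≢x

punchIn-squeeze : ∀ {m} {b x : Fin (suc (suc m))} → b ≢ x → punchIn b (squeeze b x) ≡ x
punchIn-squeeze {b = b} {x} b≢x with b ≟ x
... | yes b≡x  = contradiction b≡x b≢x
... | no  b≢x′ = punchIn-punchOut b≢x′

module FewColorRestriction {c r n s m} (H : GridSubgraph c r)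
  (rows : Fin (suc (suc m)) → Fin r → Bool) (κ : EdgeColoring n (suc (suc m)))
  (few : FewColorSet κ s) where

  vertex : Fin s → Fin n
  vertex = proj₁ few

  vertex-injective : Injective _≡_ _≡_ vertex
  vertex-injective = proj₁ (proj₂ few)

  missingColor : Fin (suc (suc m))
  missingColor = proj₁ (proj₂ (proj₂ few))

  avoidsMissingColor : ∀ u v → u ≢ v → col κ (vertex u) (vertex v) ≢ missingColor
  avoidsMissingColor = proj₂ (proj₂ (proj₂ few))

  restriction : EdgeColoring s (suc m)
  restriction = record
    { col = λ u v → squeeze missingColor (col κ (vertex u) (vertex v))
    ; sym = λ u v → cong (squeeze missingColor) (EdgeColoring.sym κ (vertex u) (vertex v))
    }

  punchIn-restriction : ∀ {u v} → u ≢ v →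
                        punchIn missingColor (col restriction u v) ≡ col κ (vertex u) (vertex v)
  punchIn-restriction {u} {v} u≢v = punchIn-squeeze (≢-sym (avoidsMissingColor u v u≢v))

  lift-ColoredCopy : ColoredCopy H (rows ∘ punchIn missingColor) restriction → ColoredCopy H rows κ
  lift-ColoredCopy (f , f-injective , edge) =
    vertex ∘ f , f-injective ∘ vertex-injective ,
    λ x y x' e → subst (λ z → T (rows z y))
                       (punchIn-restriction (sameRowEdge⇒≢ H e ∘ f-injective)) (edge x y x' e)

  lift-ColoredCoclique : ∀ {t} → ColoredCoclique (rows ∘ punchIn missingColor) restriction t →
                         ColoredCoclique rows κ t
  lift-ColoredCoclique (y , h , h-injective , nonadjacent) =
    y , vertex ∘ h , h-injective ∘ vertex-injective ,
    λ i j i≢j → subst (λ z → rows z y ≡ false)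
                      (punchIn-restriction (i≢j ∘ h-injective)) (nonadjacent i j i≢j)

module _ {c r : ℕ} (H : GridSubgraph c r) (distinct : DistinctColumnPairs H) {m : ℕ}
         (a : Fin r → Fin (suc m)) where

  private
    joiningRow? : ∀ x x' → Dec (∃ λ y → T (E H x y x' y))
    joiningRow? x x' = any? λ y → E H x y x' y ≟ᵇ true

    colorOf : ∀ {x x'} → Dec (∃ λ y → T (E H x y x' y)) → Fin (suc m)
    colorOf (yes (y , _)) = a y
    colorOf (no _)        = zero

    colorOf-sym : ∀ x x' → colorOf (joiningRow? x x') ≡ colorOf (joiningRow? x' x)
    colorOf-sym x x' with joiningRow? x x' | joiningRow? x' x
    ... | yes (y , e) | yes (y' , e') = cong a (distinct x x' y y y' y' e (E-sym H x' y' x y' e'))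
    ... | yes (y , e) | no  none      = contradiction (y , E-sym H x y x' y e) none
    ... | no  none    | yes (y' , e') = contradiction (y' , E-sym H x' y' x y' e') none
    ... | no  _       | no  _         = refl

  rowPattern : EdgeColoring c (suc m)
  rowPattern = record { col = λ x x' → colorOf (joiningRow? x x') ; sym = colorOf-sym }

  rowPattern-edge : ∀ {x y x'} → T (E H x y x' y) → col rowPattern x x' ≡ a y
  rowPattern-edge {x} {y} {x'} e with joiningRow? x x'
  ... | yes (y' , e') = cong a (distinct x x' y' y' y y e' e)
  ... | no  none      = contradiction (y , e) none

  ContainsCopy-rowPattern⇒ColoredCopy :
    ∀ {n} (rows : Fin (suc m) → Fin r → Bool) (κ : EdgeColoring n (suc m)) →
    (∀ y → T (rows (a y) y)) → ContainsCopy rowPattern κ → ColoredCopy H rows κ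
  ContainsCopy-rowPattern⇒ColoredCopy rows κ a∈ (f , f-injective , f-colors) =
    f , f-injective ,
    λ x y x' e → subst (λ z → T (rows z y))
                       (sym (trans (f-colors x x' (sameRowEdge⇒≢ H e)) (rowPattern-edge e))) (a∈ y)

RowSection : ∀ {m r} → (Fin m → Fin r → Bool) → Set
RowSection {m} {r} rows = Σ (Fin r → Fin m) λ a → ∀ y → T (rows (a y) y)

RowSection-or-emptyRow : ∀ {m r} (rows : Fin m → Fin r → Bool) →
  RowSection rows ⊎ ∃ λ y → ∀ a → rows a y ≡ false
RowSection-or-emptyRow {r = r} rows with all? (λ y → any? λ a → rows a y ≟ᵇ true)
... | yes covered = inj₁ ((λ y → proj₁ (covered y)) , λ y → proj₂ (covered y))
... | no ¬covered with ¬∀⟶∃¬ r _ (λ y → any? λ a → rows a y ≟ᵇ true) ¬covered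
...   | y , uncovered = inj₂ (y , λ a → ¬-not (λ a∋y → uncovered (a , a∋y)))

module ColorCountInduction
  (eh : MulticolorEH) {c r : ℕ} (H : GridSubgraph c r) (distinct : DistinctColumnPairs H)
  (2≤c : 2 ≤ c) (y₀ : Fin r) where

  emptyRow⇒CopyOrLargeCoclique : ∀ {m} (rows : Fin m → Fin r → Bool) →
    (∃ λ y → ∀ a → rows a y ≡ false) → CopyOrLargeCoclique H rows 1
  emptyRow⇒CopyOrLargeCoclique rows (y , empty) n κ =
    inj₂ (n , subst (n ≤_) (sym (^-identityʳ (suc n))) (n≤1+n n) ,
          y , id , id , λ i j _ → empty (col κ i j))

  fewerVerticesThanColumns⇒LargeCoclique :
    ∀ {n m} {rows : Fin m → Fin r → Bool} (κ : EdgeColoring n m) →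
    n < c → Σ ℕ λ s → n ≤ suc s ^ c × ColoredCoclique rows κ s
  fewerVerticesThanColumns⇒LargeCoclique {zero}  κ _   = 0 , z≤n , y₀ , id , id , λ ()
  fewerVerticesThanColumns⇒LargeCoclique {suc _} κ n<c =
    1 , ≤-trans (<⇒≤ n<c) (<⇒≤ (n<2^n c)) , y₀ , (λ _ → zero) ,
    (λ { {zero} {zero} _ → refl }) , λ { zero zero 0≢0 → contradiction refl 0≢0 }

  oneColor : (rows : Fin 1 → Fin r → Bool) → RowSection rows → CopyOrLargeCoclique H rows c
  oneColor rows (a , a∈) n κ with c ≤? n
  ... | yes c≤n =
    inj₁ ((λ x → inject≤ x c≤n) , (λ {x} {x'} → inject≤-injective c≤n c≤n x x') ,
          λ x y x' _ → subst (λ z → T (rows z y)) (Fin1-≡ (a y) _) (a∈ y))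
    where
    Fin1-≡ : (i j : Fin 1) → i ≡ j
    Fin1-≡ zero zero = refl
  ... | no c≰n = inj₂ (fewerVerticesThanColumns⇒LargeCoclique {rows = rows} κ (≰⇒> c≰n))

  addColor : ∀ {m} → (∀ (rows : Fin (suc m) → Fin r → Bool) → Σ ℕ (CopyOrLargeCoclique H rows)) →
             (rows : Fin (suc (suc m)) → Fin r → Bool) → RowSection rows →
             Σ ℕ (CopyOrLargeCoclique H rows)
  addColor {m} IH rows (a , a∈) = D * dₑ , copyOrCoclique
    where
    patternEH : Σ ℕ λ d → 1 ≤ d × ∀ n (κ : EdgeColoring n (suc (suc m))) →
                  ContainsCopy (rowPattern H distinct a) κ ⊎ Σ ℕ λ s → n ≤ s ^ d × FewColorSet κ s
    patternEH = eh c (suc (suc m)) 2≤c (s≤s (s≤s z≤n)) (rowPattern H distinct a)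

    dₑ : ℕ
    dₑ = proj₁ patternEH

    d : Fin (suc (suc m)) → ℕ
    d b = proj₁ (IH (rows ∘ punchIn b))

    -- The missing color depends on the coloring, so the exponent must serve every color.
    D : ℕ
    D = max 0 (tabulate d)

    d≤D : ∀ b → d b ≤ D
    d≤D = tabulate⁻ (xs≤max 0 (tabulate d))

    fewColors : ∀ {n s} (κ : EdgeColoring n (suc (suc m))) → n ≤ s ^ dₑ → FewColorSet κ s →
                ColoredCopy H rows κ ⊎ Σ ℕ λ t → n ≤ suc t ^ (D * dₑ) × ColoredCoclique rows κ t
    fewColors {s = s} κ n≤sᵉ few =
      Sum.map lift-ColoredCopy
              (λ (t , s≤tᵈ , coclique) →
                 t , nested-power-bound n≤sᵉ s≤tᵈ (d≤D missingColor) , lift-ColoredCoclique coclique)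
              (proj₂ (IH (rows ∘ punchIn missingColor)) s restriction)
      where open FewColorRestriction H rows κ few

    copyOrCoclique : CopyOrLargeCoclique H rows (D * dₑ)
    copyOrCoclique n κ =
      [ inj₁ ∘ ContainsCopy-rowPattern⇒ColoredCopy H distinct a rows κ a∈
      , (λ (s , n≤sᵉ , few) → fewColors κ n≤sᵉ few)
      ]′ (proj₂ (proj₂ patternEH) n κ)

  byRowSection : ∀ {m} (rows : Fin m → Fin r → Bool) →
    (RowSection rows → Σ ℕ (CopyOrLargeCoclique H rows)) → Σ ℕ (CopyOrLargeCoclique H rows)
  byRowSection rows withSection =
    [ withSection , (λ empty → 1 , emptyRow⇒CopyOrLargeCoclique rows empty) ]′
    (RowSection-or-emptyRow rows)

  copyOrLargeCoclique : ∀ m (rows : Fin m → Fin r → Bool) → Σ ℕ (CopyOrLargeCoclique H rows)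
  copyOrLargeCoclique zero          rows = byRowSection rows λ (a , _) → contradiction (a y₀) ¬Fin0
  copyOrLargeCoclique (suc zero)    rows = byRowSection rows λ section → c , oneColor rows section
  copyOrLargeCoclique (suc (suc m)) rows =
    byRowSection rows (addColor (copyOrLargeCoclique (suc m)) rows)

funToFin-cong : ∀ {m n} {f g : Fin m → Fin n} → f ≗ g → funToFin f ≡ funToFin g
funToFin-cong {zero}  f≗g = refl
funToFin-cong {suc m} f≗g = cong₂ combine (f≗g zero) (funToFin-cong (f≗g ∘ suc))

rowsOf : ∀ {r} → Fin (2 ^ r) → Fin r → Bool
rowsOf i = Inverse.to 2↔Bool ∘ finToFun i

encodeRows : ∀ {r} → (Fin r → Bool) → Fin (2 ^ r)
encodeRows p = funToFin (Inverse.from 2↔Bool ∘ p)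

rowsOf-encodeRows : ∀ {r} (p : Fin r → Bool) → rowsOf (encodeRows p) ≗ p
rowsOf-encodeRows p y =
  trans (cong (Inverse.to 2↔Bool) (finToFun-funToFin (Inverse.from 2↔Bool ∘ p) y))
        (Inverse.strictlyInverseˡ 2↔Bool (p y))

rowAdjacencyColoring : ∀ {N r} → GridSubgraph N r → EdgeColoring N (2 ^ r)
rowAdjacencyColoring G = record
  { col = λ u v → encodeRows λ y → E G u y v y
  ; sym = λ u v → funToFin-cong λ y → cong (Inverse.from 2↔Bool) (E-sym-≡ G u y v y)
  }

ColoredCopy⇒CopyOf : ∀ {c r N} (H : GridSubgraph c r) (G : GridSubgraph N r) → AllHorizontal H →
                     ColoredCopy H rowsOf (rowAdjacencyColoring G) → CopyOf H G
ColoredCopy⇒CopyOf H G horizontal (f , f-injective , edge) = f , id , f-injective , id , edge′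
  where
  edge′ : ∀ x y x' y' → T (E H x y x' y') → T (E G (f x) y (f x') y')
  edge′ x y x' y' e with refl ← horizontal x y x' y' e =
    trans (sym (rowsOf-encodeRows (λ z → E G (f x) z (f x') z) y)) (edge x y x' e)

ColoredCoclique⇒HorizontalCoclique : ∀ {N r s} (G : GridSubgraph N r) → Spanning G →
  ColoredCoclique rowsOf (rowAdjacencyColoring G) s → HorizontalCoclique G s
ColoredCoclique⇒HorizontalCoclique G spanning (y , g , g-injective , nonadjacent) =
  y , g , g-injective , (λ i → spanning (g i) y) , nonadjacent′
  where
  nonadjacent′ : ∀ i j → E G (g i) y (g j) y ≡ false
  nonadjacent′ i j with i ≟ j
  ... | yes refl = E-irrefl G (g i) y
  ... | no  i≢j  =
    trans (sym (rowsOf-encodeRows (λ z → E G (g i) z (g j) z) y)) (nonadjacent i j i≢j)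

HorizontalCoclique-shrink : ∀ {N r k s} (G : GridSubgraph N r) → k ≤ s →
                            HorizontalCoclique G s → HorizontalCoclique G k
HorizontalCoclique-shrink {k = k} {s} G k≤s (y , g , g-injective , inV , nonadjacent) =
  y , g ∘ ι , (λ {i} {j} → inject≤-injective k≤s k≤s i j ∘ g-injective) , inV ∘ ι ,
  λ i j → nonadjacent (ι i) (ι j)
  where
  ι : Fin k → Fin s
  ι i = inject≤ i k≤s

oneColumnCopy : ∀ {r N} (H : GridSubgraph 1 r) (G : GridSubgraph (suc N) r) →
                AllHorizontal H → CopyOf H G
oneColumnCopy H G horizontal =
  (λ _ → zero) , id , (λ { {zero} {zero} _ → refl }) , id , noEdge
  where
  noEdge : ∀ x y x' y' → T (E H x y x' y') → T (E G zero y zero y')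
  noEdge zero y zero y' e with refl ← horizontal zero y zero y' e =
    contradiction refl (sameRowEdge⇒≢ H e)

module _ {c r : ℕ} (H : GridSubgraph c r) (horizontal : AllHorizontal H) (M : ℕ)
         (copyOrCoclique : CopyOrLargeCoclique H rowsOf M) where

  HorizontalCoclique-or-CopyOf : ∀ k N → k ^ M < N → (G : GridSubgraph N r) → Spanning G →
                                 HorizontalCoclique G k ⊎ CopyOf H G
  HorizontalCoclique-or-CopyOf k N kᴹ<N G spanning with copyOrCoclique N (rowAdjacencyColoring G)
  ... | inj₁ copy                     = inj₂ (ColoredCopy⇒CopyOf H G horizontal copy)
  ... | inj₂ (s , N≤1+sᴹ , coclique) =
    inj₁ (HorizontalCoclique-shrink G (s≤s⁻¹ (^-cancelʳ-< M (<-≤-trans kᴹ<N N≤1+sᴹ)))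
                                    (ColoredCoclique⇒HorizontalCoclique G spanning coclique))

lemma5p1 : MulticolorEH →
    ∀ (c r : ℕ) → 1 ≤ c → 1 ≤ r →
    (H : GridSubgraph c r) → AllHorizontal H → DistinctColumnPairs H →
    Σ ℕ λ M → ∀ (k N : ℕ) → k ^ M < N →
      (G : GridSubgraph N r) → Spanning G →
      HorizontalCoclique G k ⊎ CopyOf H G
lemma5p1 eh (suc zero) r _ _ H horizontal _ =
  0 , λ { k (suc N) _ G _ → inj₂ (oneColumnCopy H G horizontal) }
lemma5p1 eh (suc (suc c)) (suc r) _ _ H horizontal distinct =
  let M , copyOrCoclique = copyOrLargeCoclique (2 ^ suc r) rowsOf
  in  M , HorizontalCoclique-or-CopyOf H horizontal M copyOrCoclique
  where open ColorCountInduction eh H distinct (s≤s (s≤s z≤n)) zero
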